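{- If there exists a complete uniform nested SQS$(v)$, then there exists a minimum uniform nested SQS$(2v)$.
   Context: A Steiner quadruple system SQS$(v)$ is a pair $(Q,\mathcal{B})$ where $Q$ is a set of $v$ points and $\mathcal{B}$ is a collection of 4-subsets of $Q$ (blocks) such that every 3-subset of $Q$ is contained in exactly one block. A nested SQS$(v)$ is an SQS$(v)$ together with a partition of each block into two 2-subsets (pairs). A pair of points is an ND-pair if it is one of the two pairs in the partition of at least one block; the multiplicity of a pair is the number of blocks whose partition contains that pair. A nested SQS is uniform if all its ND-pairs have the same multiplicity. A complete uniform nested SQS$(v)$ is a uniform nested SQS$(v)$ in which all $\binom{v}{2}$ pairs of points are ND-pairs (then necessarily each has multiplicity $\frac{v-2}{6}$). A minimum uniform nested SQS$(v)$ is a uniform nested SQS$(v)$ with exactly $\frac{v}{2}\left(\frac{v}{2}-1\right)$ ND-pairs (then necessarily each has multiplicity $\frac{v-1}{3}$). -}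

module Defs where

open import Data.Nat using (ℕ; _*_; _∸_; _<_; _<ᵇ_; zero; suc)
open import Data.Nat.DivMod using (_/_)
open import Data.Fin using (Fin; toℕ)
open import Data.Fin.Properties using (_≟_)
open import Data.Bool using (Bool; true; false; _∧_; _∨_; not)
open import Data.List using (List; length; filterᵇ; allFin; concatMap; map)
open import Data.List.Relation.Unary.All using (All)
open import Data.Product using (_×_; _,_; ∃)
open import Relation.Nullary.Decidable using (⌊_⌋)
open import Relation.Binary.PropositionalEquality using (_≡_; _≢_)

_==_ : ∀ {v} → Fin v → Fin v → Bool
x == y = ⌊ x ≟ y ⌋

-- A nested block (a , b , c , d) is the block {a,b,c,d} partitioned
-- into the two pairs {a,b} and {c,d}.
NBlock : ℕ → Set
NBlock v = Fin v × Fin v × Fin v × Fin v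

Distinct4 : ∀ {v} → NBlock v → Set
Distinct4 (a , b , c , d) =
  a ≢ b × a ≢ c × a ≢ d × b ≢ c × b ≢ d × c ≢ d

inBlock : ∀ {v} → Fin v → NBlock v → Bool
inBlock x (a , b , c , d) = (x == a) ∨ (x == b) ∨ (x == c) ∨ (x == d)

hasTriple : ∀ {v} → Fin v → Fin v → Fin v → NBlock v → Bool
hasTriple x y z B = inBlock x B ∧ inBlock y B ∧ inBlock z B

samePair : ∀ {v} → Fin v → Fin v → Fin v → Fin v → Bool
samePair x y a b = ((x == a) ∧ (y == b)) ∨ ((x == b) ∧ (y == a))

hasPair : ∀ {v} → Fin v → Fin v → NBlock v → Bool
hasPair x y (a , b , c , d) = samePair x y a b ∨ samePair x y c d

record NestedSQS (v : ℕ) : Set where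
  field
    blocks   : List (NBlock v)
    distinct : All Distinct4 blocks
    steiner  : ∀ (x y z : Fin v) → x ≢ y → x ≢ z → y ≢ z →
               length (filterᵇ (hasTriple x y z) blocks) ≡ 1
open NestedSQS public

mult : ∀ {v} → NestedSQS v → Fin v → Fin v → ℕ
mult N x y = length (filterᵇ (hasPair x y) (blocks N))

IsND : ∀ {v} → NestedSQS v → Fin v → Fin v → Set
IsND N x y = 0 < mult N x y

Uniform : ∀ {v} → NestedSQS v → Set
Uniform {v} N = ∃ λ (m : ℕ) → ∀ (x y : Fin v) → x ≢ y → IsND N x y → mult N x y ≡ m

pairs2 : (v : ℕ) → List (Fin v × Fin v)
pairs2 v = concatMap (λ x → filterᵇ (λ { (x' , y) → toℕ x' <ᵇ toℕ y })
                                     (map (λ y → (x , y)) (allFin v)))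
                     (allFin v)

numND : ∀ {v} → NestedSQS v → ℕ
numND {v} N = length (filterᵇ (λ { (x , y) → 0 <ᵇ mult N x y }) (pairs2 v))

CompleteUniform : ∀ {v} → NestedSQS v → Set
CompleteUniform {v} N = Uniform N × (∀ (x y : Fin v) → x ≢ y → IsND N x y)

MinimumUniform : ∀ {v} → NestedSQS v → Set
MinimumUniform {v} N = Uniform N × numND N ≡ (v / 2) * ((v / 2) ∸ 1)

{-# OPTIONS --safe #-}
module Submission where

-- Let N be a nested SQS(v) and take two copies of its points, xᵢ = combine i x for i : Fin 2.
-- Every block {a,b,c,d} of N, nested as {a,b}{c,d}, yields eight nested blocks: the block
-- itself in either copy, and for each of its three splittings {p,q}{r,s} the blocks
-- {pᵢ,qᵢ}{r₁₋ᵢ,s₁₋ᵢ}; every pair {a,b} of points yields the block {a₀,b₀}{a₁,b₁}.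
-- A triple over three distinct points of N lies in exactly one of the eight blocks coming
-- from the unique block of N through those points, and in no pair block; a triple
-- containing both copies of a point lies in exactly one pair block and in no other block.
-- Every nested pair lies inside one copy, and {xᵢ,yᵢ} is nested once among the eight blocks
-- of each of the (v-2)/2 blocks of N through x and y, once more for each block of N in which
-- {x,y} is nested, and once in a pair block.  So a complete uniform N, with multiplicity μ,
-- gives a double in which exactly the v(v-1) pairs inside a copy are nested, each
-- (v-2)/2 + μ + 1 times.  Relative to one block of N, these incidences only depend on the
-- copies of the points and their positions in the block, so they are checked by computation
-- on fixed templates.

open import Defs

import Data.Nat.Properties as ℕ
open import Algebra.Properties.CommutativeMonoid.Sum ℕ.+-0-commutativeMonoid
  using (sum; sum-syntax; sum-cong-≗; sum-replicate-zero; ∑-distrib-+; ∑-comm)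
open import Algebra.Properties.CommutativeSemigroup ℕ.+-commutativeSemigroup using (interchange)
open import Algebra.Properties.Semiring.Sum ℕ.+-*-semiring using (*-distribˡ-sum)
open import Data.Bool using (Bool; true; false; _∧_; _∨_; not)
open import Data.Bool.Properties using (∧-zeroʳ; ∧-identityʳ; ∧-comm; ∧-assoc; ∨-comm; ∨-identityʳ)
import Data.Bool.Properties as Bool
open import Data.Empty using (⊥; ⊥-elim)
open import Data.Fin using (Fin; zero; suc; toℕ; combine; _↑ˡ_; _↑ʳ_)
open import Data.Fin.Patterns using (0F; 1F; 2F; 3F)
open import Data.Fin.Properties
  using (_≟_; all?; any?; combine-injective; combine-surjective; toℕ-injective)
open import Data.List using (List; []; _∷_; _++_; length; filterᵇ; map; concatMap; allFin; tabulate)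
import Data.List.Properties as List
open import Data.List.Relation.Unary.All as All using (All; []; _∷_)
import Data.List.Relation.Unary.All.Properties as Allₚ
open import Data.Maybe using (Maybe; just; nothing)
open import Data.Nat using (ℕ; zero; suc; _+_; _*_; _∸_; _<_; _<ᵇ_)
open import Data.Nat.DivMod using (_/_; m*n/n≡m)
open import Data.Product using (_×_; _,_; ∃; uncurry)
import Data.Product.Properties as Product
open import Data.Unit using (⊤; tt)
open import Function using (_∘_; id; mk⇔)
open import Function.Definitions using (Injective)
open import Relation.Binary.Definitions using (DecidableEquality; tri<; tri≈; tri>)
open import Relation.Binary.PropositionalEquality
open import Relation.Nullary using (Dec; yes; no; ¬?; _×-dec_; _→-dec_; _because_; T?)
open import Relation.Nullary.Decidable
  using (does; isYes; from-yes; map′; dec-true; dec-false; does-⇔; isYes≗does)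
open import Relation.Nullary.Negation using (contradiction)

open ≡-Reasoning

-- Indicators, counting and finite sums

⟦_⟧ : Bool → ℕ
⟦ true  ⟧ = 1
⟦ false ⟧ = 0

⟦∧⟧ : ∀ a b → ⟦ a ∧ b ⟧ ≡ ⟦ a ⟧ * ⟦ b ⟧
⟦∧⟧ true  b = sym (ℕ.+-identityʳ ⟦ b ⟧)
⟦∧⟧ false b = refl

⟦not⟧ : ∀ b → ⟦ not b ⟧ + ⟦ b ⟧ ≡ 1
⟦not⟧ true  = refl
⟦not⟧ false = refl

⟦⟧-split : ∀ p q b → p ∧ q ≡ false → ⟦ b ⟧ ≡ ⟦ (not p ∧ not q) ∧ b ⟧ + ⟦ p ∧ b ⟧ + ⟦ q ∧ b ⟧
⟦⟧-split true  true  b     ()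
⟦⟧-split true  false b     _ = sym (ℕ.+-identityʳ ⟦ b ⟧)
⟦⟧-split false true  b     _ = refl
⟦⟧-split false false true  _ = refl
⟦⟧-split false false false _ = refl

count : {A : Set} → (A → Bool) → List A → ℕ
count p xs = length (filterᵇ p xs)

∑ᴸ : {A : Set} → List A → (A → ℕ) → ℕ
∑ᴸ []       f = 0
∑ᴸ (x ∷ xs) f = f x + ∑ᴸ xs f

infixl 10 ∑ᴸ
syntax ∑ᴸ xs (λ x → e) = ∑[ x ∈ xs ] e

module _ {A : Set} where

  ∑ᴸ-cong : {f g : A → ℕ} → (∀ x → f x ≡ g x) → ∀ xs → ∑ᴸ xs f ≡ ∑ᴸ xs g
  ∑ᴸ-cong f≗g []       = refl
  ∑ᴸ-cong f≗g (x ∷ xs) = cong₂ _+_ (f≗g x) (∑ᴸ-cong f≗g xs)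

  ∑ᴸ-cong-All : {P : A → Set} {f g : A → ℕ} → (∀ {x} → P x → f x ≡ g x) →
                ∀ {xs} → All P xs → ∑ᴸ xs f ≡ ∑ᴸ xs g
  ∑ᴸ-cong-All f≗g []         = refl
  ∑ᴸ-cong-All f≗g (px ∷ pxs) = cong₂ _+_ (f≗g px) (∑ᴸ-cong-All f≗g pxs)

  ∑ᴸ-zero : (xs : List A) → ∑[ x ∈ xs ] 0 ≡ 0
  ∑ᴸ-zero []       = refl
  ∑ᴸ-zero (x ∷ xs) = ∑ᴸ-zero xs

  ∑ᴸ-+ : (f g : A → ℕ) → ∀ xs → ∑[ x ∈ xs ] (f x + g x) ≡ ∑ᴸ xs f + ∑ᴸ xs g
  ∑ᴸ-+ f g []       = refl
  ∑ᴸ-+ f g (x ∷ xs) = trans (cong (f x + g x +_) (∑ᴸ-+ f g xs)) (interchange (f x) (g x) _ _)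

  ∑ᴸ-* : ∀ c (f : A → ℕ) xs → ∑[ x ∈ xs ] (c * f x) ≡ c * ∑ᴸ xs f
  ∑ᴸ-* c f []       = sym (ℕ.*-zeroʳ c)
  ∑ᴸ-* c f (x ∷ xs) = trans (cong (c * f x +_) (∑ᴸ-* c f xs)) (sym (ℕ.*-distribˡ-+ c (f x) _))

  ∑ᴸ-∑ : ∀ {n} (h : A → Fin n → ℕ) xs → ∑[ x ∈ xs ] ∑[ z < n ] h x z ≡ ∑[ z < n ] ∑[ x ∈ xs ] h x z
  ∑ᴸ-∑ {n} h []       = sym (sum-replicate-zero n)
  ∑ᴸ-∑     h (x ∷ xs) = trans (cong (sum (h x) +_) (∑ᴸ-∑ h xs)) (sym (∑-distrib-+ (h x) _))

  ∑ᴸ-tabulate : ∀ {n} (g : Fin n → A) (f : A → ℕ) → ∑ᴸ (tabulate g) f ≡ ∑[ i < n ] f (g i)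
  ∑ᴸ-tabulate {zero}  g f = refl
  ∑ᴸ-tabulate {suc n} g f = cong (f (g zero) +_) (∑ᴸ-tabulate (g ∘ suc) f)

  count≡∑ : (p : A → Bool) (xs : List A) → count p xs ≡ ∑[ x ∈ xs ] ⟦ p x ⟧
  count≡∑ p []       = refl
  count≡∑ p (x ∷ xs) with p x
  ... | true  = cong suc (count≡∑ p xs)
  ... | false = count≡∑ p xs

  count-cong : {p q : A → Bool} → (∀ x → p x ≡ q x) → ∀ xs → count p xs ≡ count q xs
  count-cong {p} {q} p≗q xs =
    trans (count≡∑ p xs) (trans (∑ᴸ-cong (cong ⟦_⟧ ∘ p≗q) xs) (sym (count≡∑ q xs)))

  count-cong-All : {P : A → Set} {p q : A → Bool} → (∀ {x} → P x → p x ≡ q x) →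
                   ∀ {xs} → All P xs → count p xs ≡ count q xs
  count-cong-All {p = p} {q} p≗q {xs} pxs =
    trans (count≡∑ p xs) (trans (∑ᴸ-cong-All (cong ⟦_⟧ ∘ p≗q) pxs) (sym (count≡∑ q xs)))

  count-none : {P : A → Set} {p : A → Bool} → (∀ {x} → P x → p x ≡ false) →
               ∀ {xs} → All P xs → count p xs ≡ 0
  count-none none {xs} pxs =
    trans (count-cong-All {q = λ _ → false} none pxs) (trans (count≡∑ (λ _ → false) xs) (∑ᴸ-zero xs))

  count-++ : (p : A → Bool) (xs ys : List A) → count p (xs ++ ys) ≡ count p xs + count p ys
  count-++ p xs ys =
    trans (cong length (List.filter-++ (T? ∘ p) xs ys)) (List.length-++ (filterᵇ p xs))

  count-filterᵇ : (p q : A → Bool) (xs : List A) → count p (filterᵇ q xs) ≡ count (λ x → q x ∧ p x) xs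
  count-filterᵇ p q []       = refl
  count-filterᵇ p q (x ∷ xs) with q x
  ... | false = count-filterᵇ p q xs
  ... | true with p x
  ...   | true  = cong suc (count-filterᵇ p q xs)
  ...   | false = count-filterᵇ p q xs

module _ {A B : Set} where

  count-map : (p : B → Bool) (f : A → B) (xs : List A) → count p (map f xs) ≡ count (p ∘ f) xs
  count-map p f []       = refl
  count-map p f (x ∷ xs) with p (f x)
  ... | true  = cong suc (count-map p f xs)
  ... | false = count-map p f xs

  count-concatMap : (p : B → Bool) (f : A → List B) (xs : List A) →
                    count p (concatMap f xs) ≡ ∑[ x ∈ xs ] count p (f x)
  count-concatMap p f []       = refl
  count-concatMap p f (x ∷ xs) =
    trans (count-++ p (f x) _) (cong (count p (f x) +_) (count-concatMap p f xs))

∑-const : ∀ n c → ∑[ i < n ] c ≡ n * c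
∑-const zero    c = refl
∑-const (suc n) c = cong (c +_) (∑-const n c)

∑-zero : ∀ {n} {f : Fin n → ℕ} → (∀ z → f z ≡ 0) → ∑[ z < n ] f z ≡ 0
∑-zero {n} f≡0 = trans (sum-cong-≗ f≡0) (sum-replicate-zero n)

∑-ones : ∀ n → ∑[ i < n ] 1 ≡ n
∑-ones n = trans (∑-const n 1) (ℕ.*-identityʳ n)

∑-↑ : ∀ m n (f : Fin (m + n) → ℕ) →
      ∑[ p < m + n ] f p ≡ ∑[ i < m ] f (i ↑ˡ n) + ∑[ j < n ] f (m ↑ʳ j)
∑-↑ zero    n f = refl
∑-↑ (suc m) n f = trans (cong (f zero +_) (∑-↑ m n (f ∘ suc))) (sym (ℕ.+-assoc (f zero) _ _))

∑-combine : ∀ m n (f : Fin (m * n) → ℕ) → ∑[ p < m * n ] f p ≡ ∑[ i < m ] ∑[ j < n ] f (combine i j)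
∑-combine zero    n f = refl
∑-combine (suc m) n f =
  trans (∑-↑ n (m * n) f) (cong (∑[ j < n ] f (j ↑ˡ (m * n)) +_) (∑-combine m n (f ∘ (n ↑ʳ_))))

-- x == y is isYes (x ≟ y), which is stuck on undecided comparisons (even suc x == suc y
-- does not reduce to x == y), so facts about _==_ are routed through does.
==-does : ∀ {n} (x y : Fin n) → (x == y) ≡ does (x ≟ y)
==-does x y = isYes≗does (x ≟ y)

==-≢ : ∀ {n} {x y : Fin n} → x ≢ y → (x == y) ≡ false
==-≢ {x = x} {y} x≢y = trans (==-does x y) (dec-false (x ≟ y) x≢y)

==-suc : ∀ {n} (x y : Fin n) → (suc x == suc y) ≡ (x == y)
==-suc x y = trans (==-does (suc x) (suc y)) (sym (==-does x y))

==-sym : ∀ {n} (x y : Fin n) → (x == y) ≡ (y == x)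
==-sym x y = trans (==-does x y) (trans (does-⇔ (mk⇔ sym sym) (x ≟ y) (y ≟ x)) (sym (==-does y x)))

==-injective : ∀ {m n} {f : Fin m → Fin n} → Injective _≡_ _≡_ f → ∀ x y → (f x == f y) ≡ (x == y)
==-injective {f = f} f-inj x y =
  trans (==-does (f x) (f y)) (trans (does-⇔ (mk⇔ f-inj (cong f)) (f x ≟ f y) (x ≟ y)) (sym (==-does x y)))

combine-== : ∀ {m n} (i j : Fin m) (x y : Fin n) → (combine i x == combine j y) ≡ (i == j) ∧ (x == y)
combine-== i j x y = begin
  combine i x == combine j y        ≡⟨ ==-does (combine i x) (combine j y) ⟩
  does (combine i x ≟ combine j y)  ≡⟨ does-⇔ (mk⇔ (combine-injective i x j y) (uncurry (cong₂ combine)))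
                                              (combine i x ≟ combine j y) (i ≟ j ×-dec x ≟ y) ⟩
  does (i ≟ j) ∧ does (x ≟ y)       ≡⟨ cong₂ _∧_ (==-does i j) (==-does x y) ⟨
  (i == j) ∧ (x == y)               ∎

==-exclusive : ∀ {n} {x y : Fin n} → x ≢ y → ∀ z → (x == z) ∧ (y == z) ≡ false
==-exclusive {x = x} x≢y z with x ≟ z
... | yes refl = ==-≢ (x≢y ∘ sym)
... | no _     = refl

∑-δ : ∀ {n} (x : Fin n) (f : Fin n → ℕ) → ∑[ z < n ] (⟦ x == z ⟧ * f z) ≡ f x
∑-δ {suc n} zero    f =
  trans (cong₂ _+_ (ℕ.+-identityʳ (f zero)) (∑-zero {n} (λ _ → refl))) (ℕ.+-identityʳ (f zero))
∑-δ {suc n} (suc x) f =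
  trans (sum-cong-≗ (λ z → cong (λ b → ⟦ b ⟧ * f (suc z)) (==-suc x z))) (∑-δ x (f ∘ suc))

∑-δ∧ : ∀ {n} (x : Fin n) (b : Fin n → Bool) → ∑[ z < n ] ⟦ (x == z) ∧ b z ⟧ ≡ ⟦ b x ⟧
∑-δ∧ x b = trans (sum-cong-≗ (λ z → ⟦∧⟧ (x == z) (b z))) (∑-δ x (⟦_⟧ ∘ b))

∑-indicator : ∀ {n} (x : Fin n) → ∑[ z < n ] ⟦ x == z ⟧ ≡ 1
∑-indicator x = trans (sum-cong-≗ (λ z → sym (ℕ.*-identityʳ ⟦ x == z ⟧))) (∑-δ x (λ _ → 1))

avoiding : ∀ {n} → Fin n → Fin n → Fin n → Bool
avoiding x y z = not (x == z) ∧ not (y == z)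

∑-remove₂ : ∀ {n} {x y : Fin n} → x ≢ y → (b : Fin n → Bool) →
            ∑[ z < n ] ⟦ avoiding x y z ∧ b z ⟧ + ⟦ b x ⟧ + ⟦ b y ⟧ ≡ ∑[ z < n ] ⟦ b z ⟧
∑-remove₂ {n} {x} {y} x≢y b = sym (begin
  ∑[ z < n ] ⟦ b z ⟧         ≡⟨ sum-cong-≗ (λ z → ⟦⟧-split (x == z) (y == z) (b z) (==-exclusive x≢y z)) ⟩
  ∑[ z < n ] (A z + X z + Y z) ≡⟨ trans (∑-distrib-+ (λ z → A z + X z) Y) (cong (_+ sum Y) (∑-distrib-+ A X)) ⟩
  sum A + sum X + sum Y      ≡⟨ cong₂ (λ s t → sum A + s + t) (∑-δ∧ x b) (∑-δ∧ y b) ⟩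
  sum A + ⟦ b x ⟧ + ⟦ b y ⟧  ∎)
  where
  A X Y : Fin n → ℕ
  A z = ⟦ avoiding x y z ∧ b z ⟧
  X z = ⟦ (x == z) ∧ b z ⟧
  Y z = ⟦ (y == z) ∧ b z ⟧

∑-others : ∀ {n} (x : Fin n) → ∑[ z < n ] ⟦ not (x == z) ⟧ ≡ n ∸ 1
∑-others {n} x = begin
  S                              ≡⟨ ℕ.m+n∸n≡m S 1 ⟨
  S + 1 ∸ 1                      ≡⟨ cong (λ t → S + t ∸ 1) (∑-indicator x) ⟨
  S + ∑[ z < n ] ⟦ x == z ⟧ ∸ 1  ≡⟨ cong (_∸ 1) (∑-distrib-+ (λ z → ⟦ not (x == z) ⟧) (λ z → ⟦ x == z ⟧)) ⟨
  ∑[ z < n ] (⟦ not (x == z) ⟧ + ⟦ x == z ⟧) ∸ 1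
                                 ≡⟨ cong (_∸ 1) (trans (sum-cong-≗ (⟦not⟧ ∘ (x ==_))) (∑-ones n)) ⟩
  n ∸ 1                          ∎
  where
  S = ∑[ z < n ] ⟦ not (x == z) ⟧

∑-others₂ : ∀ {n} {x y : Fin n} → x ≢ y → ∑[ z < n ] ⟦ avoiding x y z ⟧ ≡ n ∸ 2
∑-others₂ {n} {x} {y} x≢y = begin
  S                                          ≡⟨ ℕ.m+n∸n≡m S 2 ⟨
  S + 2 ∸ 2                                  ≡⟨ cong (_∸ 2) (ℕ.+-assoc S 1 1) ⟨
  S + 1 + 1 ∸ 2                              ≡⟨ cong (λ t → t + 1 + 1 ∸ 2) (sum-cong-≗ avoiding∧true) ⟨
  ∑[ z < n ] ⟦ avoiding x y z ∧ true ⟧ + 1 + 1 ∸ 2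
                                             ≡⟨ cong (_∸ 2) (trans (∑-remove₂ x≢y (λ _ → true)) (∑-ones n)) ⟩
  n ∸ 2                                      ∎
  where
  S = ∑[ z < n ] ⟦ avoiding x y z ⟧
  avoiding∧true : ∀ z → ⟦ avoiding x y z ∧ true ⟧ ≡ ⟦ avoiding x y z ⟧
  avoiding∧true z = cong ⟦_⟧ (∧-identityʳ (avoiding x y z))

-- Quadruples and incidence

Quad : Set → Set
Quad A = A × A × A × A

mapQuad : {A B : Set} → (A → B) → Quad A → Quad B
mapQuad f (a , b , c , d) = f a , f b , f c , f d

indices : Quad (Fin 4)
indices = 0F , 1F , 2F , 3F

module _ {A : Set} where

  corner : Quad A → Fin 4 → A
  corner (a , b , c , d) 0F = a
  corner (a , b , c , d) 1F = b
  corner (a , b , c , d) 2F = c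
  corner (a , b , c , d) 3F = d

  Distinct : Quad A → Set
  Distinct (a , b , c , d) = a ≢ b × a ≢ c × a ≢ d × b ≢ c × b ≢ d × c ≢ d

  Distinct? : DecidableEquality A → (T : Quad A) → Dec (Distinct T)
  Distinct? _≟ᴬ_ (a , b , c , d) =
    ¬? (a ≟ᴬ b) ×-dec ¬? (a ≟ᴬ c) ×-dec ¬? (a ≟ᴬ d) ×-dec ¬? (b ≟ᴬ c) ×-dec ¬? (b ≟ᴬ d) ×-dec ¬? (c ≟ᴬ d)

  corner-injective : {T : Quad A} → Distinct T → Injective _≡_ _≡_ (corner T)
  corner-injective (ab , ac , ad , bc , bd , cd) {i} {j} = go i j
    where
    go : ∀ i j → corner _ i ≡ corner _ j → i ≡ j
    go 0F 0F _ = refl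
    go 0F 1F e = contradiction e ab
    go 0F 2F e = contradiction e ac
    go 0F 3F e = contradiction e ad
    go 1F 0F e = contradiction (sym e) ab
    go 1F 1F _ = refl
    go 1F 2F e = contradiction e bc
    go 1F 3F e = contradiction e bd
    go 2F 0F e = contradiction (sym e) ac
    go 2F 1F e = contradiction (sym e) bc
    go 2F 2F _ = refl
    go 2F 3F e = contradiction e cd
    go 3F 0F e = contradiction (sym e) ad
    go 3F 1F e = contradiction (sym e) bd
    go 3F 2F e = contradiction (sym e) cd
    go 3F 3F _ = refl

  endpoints : A × A → Fin 2 → A
  endpoints (a , b) 0F = a
  endpoints (a , b) 1F = b

  endpoints-injective : {a b : A} → a ≢ b → Injective _≡_ _≡_ (endpoints (a , b))
  endpoints-injective a≢b {0F} {0F} _ = refl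
  endpoints-injective a≢b {0F} {1F} e = contradiction e a≢b
  endpoints-injective a≢b {1F} {0F} e = contradiction (sym e) a≢b
  endpoints-injective a≢b {1F} {1F} _ = refl

Distinct-map : {A B : Set} {f : A → B} → Injective _≡_ _≡_ f → {T : Quad A} → Distinct T →
               Distinct (mapQuad f T)
Distinct-map f-inj (ab , ac , ad , bc , bd , cd) =
  ab ∘ f-inj , ac ∘ f-inj , ad ∘ f-inj , bc ∘ f-inj , bd ∘ f-inj , cd ∘ f-inj

module _ {P Q : Set} (_≈_ : P → Q → Bool) where

  isPair : P → P → Q → Q → Bool
  isPair x y a b = (x ≈ a ∧ y ≈ b) ∨ (x ≈ b ∧ y ≈ a)

  inQuad : P → Quad Q → Bool
  inQuad x (a , b , c , d) = x ≈ a ∨ x ≈ b ∨ x ≈ c ∨ x ≈ d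

  pairOf : P → P → Quad Q → Bool
  pairOf x y (a , b , c , d) = isPair x y a b ∨ isPair x y c d

  tripleIn : P → P → P → Quad Q → Bool
  tripleIn x y z T = inQuad x T ∧ inQuad y T ∧ inQuad z T

module _ {v} {P Q : Set} (_≈_ : P → Q → Bool) (f : Q → Fin v) where

  record Coordinate (x : Fin v) (x′ : P) : Set where
    constructor coordinate
    field agrees : ∀ s → (x == f s) ≡ (x′ ≈ s)

  open Coordinate public

  samePair-map : ∀ {x y x′ y′} → Coordinate x x′ → Coordinate y y′ →
                 ∀ a b → samePair x y (f a) (f b) ≡ isPair _≈_ x′ y′ a b
  samePair-map cx cy a b =
    cong₂ _∨_ (cong₂ _∧_ (agrees cx a) (agrees cy b)) (cong₂ _∧_ (agrees cx b) (agrees cy a))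

  inBlock-map : ∀ {x x′} → Coordinate x x′ → ∀ T → inBlock x (mapQuad f T) ≡ inQuad _≈_ x′ T
  inBlock-map cx (a , b , c , d) =
    cong₂ _∨_ (agrees cx a) (cong₂ _∨_ (agrees cx b) (cong₂ _∨_ (agrees cx c) (agrees cx d)))

  hasPair-map : ∀ {x y x′ y′} → Coordinate x x′ → Coordinate y y′ →
                ∀ T → hasPair x y (mapQuad f T) ≡ pairOf _≈_ x′ y′ T
  hasPair-map cx cy (a , b , c , d) = cong₂ _∨_ (samePair-map cx cy a b) (samePair-map cx cy c d)

  hasTriple-map : ∀ {x y z x′ y′ z′} → Coordinate x x′ → Coordinate y y′ → Coordinate z z′ →
                  ∀ T → hasTriple x y z (mapQuad f T) ≡ tripleIn _≈_ x′ y′ z′ T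
  hasTriple-map cx cy cz T =
    cong₂ _∧_ (inBlock-map cx T) (cong₂ _∧_ (inBlock-map cy T) (inBlock-map cz T))

_≐_ : ∀ {n} → Maybe (Fin n) → Fin n → Bool
just k  ≐ l = k == l
nothing ≐ l = false

Apart : ∀ {n} → Maybe (Fin n) → Maybe (Fin n) → Set
Apart (just k) (just l) = k ≢ l
Apart _        _        = ⊤

Apart? : ∀ {n} (m o : Maybe (Fin n)) → Dec (Apart m o)
Apart? (just k) (just l) = ¬? (k ≟ l)
Apart? (just k) nothing  = yes tt
Apart? nothing  _        = yes tt

module _ {n v} (g : Fin n → Fin v) where

  position : Fin v → Maybe (Fin n)
  position x with any? (λ k → g k ≟ x)
  ... | yes (k , _) = just k
  ... | no _        = nothing

  position-coordinate : Injective _≡_ _≡_ g → ∀ x → Coordinate _≐_ g x (position x)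
  position-coordinate g-inj x with any? (λ k → g k ≟ x)
  ... | yes (k , refl) = coordinate (==-injective g-inj k)
  ... | no ∄k          = coordinate λ l → ==-≢ (λ x≡gl → ∄k (l , sym x≡gl))

  position-apart : ∀ {x y} → x ≢ y → Apart (position x) (position y)
  position-apart {x} {y} x≢y with any? (λ k → g k ≟ x) | any? (λ k → g k ≟ y)
  ... | yes (k , refl) | yes (l , refl) = x≢y ∘ cong g
  ... | yes _          | no _           = tt
  ... | no _           | _              = tt

-- A point of the double seen from a block: its copy, and its position in the block (if any).
Local : ℕ → Set
Local n = Fin 2 × Maybe (Fin n)

matches : ∀ {n} → Local n → Fin 2 × Fin n → Bool
matches (i , m) (j , k) = (i == j) ∧ (m ≐ k)

realise : ∀ {n v} → (Fin n → Fin v) → Fin 2 × Fin n → Fin (2 * v)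
realise g (i , k) = combine i (g k)

module _ {n v} {g : Fin n → Fin v} (g-inj : Injective _≡_ _≡_ g) where

  realise-injective : Injective _≡_ _≡_ (realise g)
  realise-injective {i , k} {j , l} e with combine-injective i (g k) j (g l) e
  ... | refl , gk≡gl = cong (i ,_) (g-inj gk≡gl)

  realise-coordinate : ∀ i x → Coordinate matches (realise g) (combine i x) (i , position g x)
  realise-coordinate i x = coordinate λ (j , k) →
    trans (combine-== i j x (g k)) (cong ((i == j) ∧_) (agrees (position-coordinate g g-inj x) k))

-- Template points are (copy , index), the index standing for a corner of a block of N
-- (respectively an end of a pair).
blockTemplates : List (Quad (Fin 2 × Fin 4))
blockTemplates =
    ((0F , 0F) , (0F , 1F) , (0F , 2F) , (0F , 3F))
  ∷ ((1F , 0F) , (1F , 1F) , (1F , 2F) , (1F , 3F))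
  ∷ ((0F , 0F) , (0F , 1F) , (1F , 2F) , (1F , 3F))
  ∷ ((1F , 0F) , (1F , 1F) , (0F , 2F) , (0F , 3F))
  ∷ ((0F , 0F) , (0F , 2F) , (1F , 1F) , (1F , 3F))
  ∷ ((1F , 0F) , (1F , 2F) , (0F , 1F) , (0F , 3F))
  ∷ ((0F , 0F) , (0F , 3F) , (1F , 1F) , (1F , 2F))
  ∷ ((1F , 0F) , (1F , 3F) , (0F , 1F) , (0F , 2F))
  ∷ []

pairTemplate : Quad (Fin 2 × Fin 2)
pairTemplate = (0F , 0F) , (0F , 1F) , (1F , 0F) , (1F , 1F)

all-Maybe? : ∀ {n} {P : Maybe (Fin n) → Set} → (∀ m → Dec (P m)) → Dec (∀ m → P m)
all-Maybe? P? = map′ (λ { (p₀ , p₁) nothing → p₀ ; (p₀ , p₁) (just k) → p₁ k })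
                     (λ p → p nothing , p ∘ just)
                     (P? nothing ×-dec all? (P? ∘ just))

blockTemplates-distinct : All Distinct blockTemplates
blockTemplates-distinct = from-yes (All.all? (Distinct? (Product.≡-dec _≟_ _≟_)) blockTemplates)

pairTemplate-distinct : Distinct pairTemplate
pairTemplate-distinct = from-yes (Distinct? (Product.≡-dec _≟_ _≟_) pairTemplate)

inQuad-indices : ∀ m → ⟦ inQuad _≐_ m indices ⟧ ≡ ∑[ k < 4 ] ⟦ m ≐ k ⟧
inQuad-indices = from-yes (all-Maybe? λ m → ⟦ inQuad _≐_ m indices ⟧ ℕ.≟ ∑[ k < 4 ] ⟦ m ≐ k ⟧)

blockTemplates-triple : ∀ i j k (m n o : Maybe (Fin 4)) → Apart m n → Apart m o → Apart n o →
  count (tripleIn matches (i , m) (j , n) (k , o)) blockTemplates ≡ ⟦ tripleIn _≐_ m n o indices ⟧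
blockTemplates-triple = from-yes
  (all? λ i → all? λ j → all? λ k → all-Maybe? λ m → all-Maybe? λ n → all-Maybe? λ o →
   Apart? m n →-dec Apart? m o →-dec Apart? n o →-dec
   count (tripleIn matches (i , m) (j , n) (k , o)) blockTemplates ℕ.≟ ⟦ tripleIn _≐_ m n o indices ⟧)

blockTemplates-twin-triple : ∀ i j k (m o : Maybe (Fin 4)) → i ≢ j →
  count (tripleIn matches (i , m) (j , m) (k , o)) blockTemplates ≡ 0
blockTemplates-twin-triple = from-yes
  (all? λ i → all? λ j → all? λ k → all-Maybe? λ m → all-Maybe? λ o →
   ¬? (i ≟ j) →-dec count (tripleIn matches (i , m) (j , m) (k , o)) blockTemplates ℕ.≟ 0)

blockTemplates-pair : ∀ i (m n : Maybe (Fin 4)) → Apart m n →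
  count (pairOf matches (i , m) (i , n)) blockTemplates ≡
  ⟦ inQuad _≐_ m indices ∧ inQuad _≐_ n indices ⟧ + ⟦ pairOf _≐_ m n indices ⟧
blockTemplates-pair = from-yes
  (all? λ i → all-Maybe? λ m → all-Maybe? λ n → Apart? m n →-dec
   count (pairOf matches (i , m) (i , n)) blockTemplates ℕ.≟
   ⟦ inQuad _≐_ m indices ∧ inQuad _≐_ n indices ⟧ + ⟦ pairOf _≐_ m n indices ⟧)

blockTemplates-cross-pair : ∀ i j (m n : Maybe (Fin 4)) → i ≢ j →
  count (pairOf matches (i , m) (j , n)) blockTemplates ≡ 0
blockTemplates-cross-pair = from-yes
  (all? λ i → all? λ j → all-Maybe? λ m → all-Maybe? λ n →
   ¬? (i ≟ j) →-dec count (pairOf matches (i , m) (j , n)) blockTemplates ℕ.≟ 0)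

pairTemplate-triple : ∀ i j k (m n o : Maybe (Fin 2)) → Apart m n → Apart m o → Apart n o →
  tripleIn matches (i , m) (j , n) (k , o) pairTemplate ≡ false
pairTemplate-triple = from-yes
  (all? λ i → all? λ j → all? λ k → all-Maybe? λ m → all-Maybe? λ n → all-Maybe? λ o →
   Apart? m n →-dec Apart? m o →-dec Apart? n o →-dec
   tripleIn matches (i , m) (j , n) (k , o) pairTemplate Bool.≟ false)

pairTemplate-twin-triple : ∀ i j k (m o : Maybe (Fin 2)) → i ≢ j → Apart m o →
  tripleIn matches (i , m) (j , m) (k , o) pairTemplate ≡ isPair _≐_ m o 0F 1F
pairTemplate-twin-triple = from-yes
  (all? λ i → all? λ j → all? λ k → all-Maybe? λ m → all-Maybe? λ o →
   ¬? (i ≟ j) →-dec Apart? m o →-dec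
   tripleIn matches (i , m) (j , m) (k , o) pairTemplate Bool.≟ isPair _≐_ m o 0F 1F)

pairTemplate-pair : ∀ i (m n : Maybe (Fin 2)) →
  pairOf matches (i , m) (i , n) pairTemplate ≡ isPair _≐_ m n 0F 1F
pairTemplate-pair = from-yes
  (all? λ i → all-Maybe? λ m → all-Maybe? λ n →
   pairOf matches (i , m) (i , n) pairTemplate Bool.≟ isPair _≐_ m n 0F 1F)

pairTemplate-cross-pair : ∀ i j (m n : Maybe (Fin 2)) → i ≢ j →
  pairOf matches (i , m) (j , n) pairTemplate ≡ false
pairTemplate-cross-pair = from-yes
  (all? λ i → all? λ j → all-Maybe? λ m → all-Maybe? λ n →
   ¬? (i ≟ j) →-dec pairOf matches (i , m) (j , n) pairTemplate Bool.≟ false)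

<ᵇ-dec : ∀ m n → Dec (m < n)
<ᵇ-dec m n = (m <ᵇ n) because ℕ.<ᵇ-reflects-< m n

⟦<ᵇ⟧-split : ∀ {n} (a b : Fin n) (r : Bool) → (a ≡ b → r ≡ false) →
             ⟦ (toℕ a <ᵇ toℕ b) ∧ r ⟧ + ⟦ (toℕ b <ᵇ toℕ a) ∧ r ⟧ ≡ ⟦ r ⟧
⟦<ᵇ⟧-split a b r diag with ℕ.<-cmp (toℕ a) (toℕ b)
... | tri< a<b _ b≮a rewrite dec-true (<ᵇ-dec _ _) a<b | dec-false (<ᵇ-dec _ _) b≮a = ℕ.+-identityʳ ⟦ r ⟧
... | tri> a≮b _ b<a rewrite dec-false (<ᵇ-dec _ _) a≮b | dec-true (<ᵇ-dec _ _) b<a = refl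
... | tri≈ _ a≡b _
  rewrite diag (toℕ-injective a≡b) | ∧-zeroʳ (toℕ a <ᵇ toℕ b) | ∧-zeroʳ (toℕ b <ᵇ toℕ a) = refl

pairs2-distinct : ∀ {n} → All (uncurry _≢_) (pairs2 n)
pairs2-distinct {n} = Allₚ.concat⁺ (Allₚ.map⁺ (All.universal row (allFin n)))
  where
  row : ∀ a → All (uncurry _≢_) (filterᵇ (uncurry λ x y → toℕ x <ᵇ toℕ y) (map (a ,_) (allFin n)))
  row a = All.map (λ x<y x≡y → ℕ.<⇒≢ (ℕ.<ᵇ⇒< _ _ x<y) (cong toℕ x≡y))
                  (Allₚ.all-filter (T? ∘ uncurry λ x y → toℕ x <ᵇ toℕ y) (map (a ,_) (allFin n)))

count-pairs2 : ∀ {n} (p : Fin n × Fin n → Bool) →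
               count p (pairs2 n) ≡ ∑[ a < n ] ∑[ b < n ] ⟦ (toℕ a <ᵇ toℕ b) ∧ p (a , b) ⟧
count-pairs2 {n} p =
  trans (count-concatMap p _ (allFin n))
        (trans (∑ᴸ-cong (row _) (allFin n)) (∑ᴸ-tabulate id (λ a → ∑[ b < n ] ⟦ (toℕ a <ᵇ toℕ b) ∧ p (a , b) ⟧)))
  where
  row : (q : Fin n × Fin n → Bool) (a : Fin n) →
        count p (filterᵇ q (map (a ,_) (allFin n))) ≡ ∑[ b < n ] ⟦ q (a , b) ∧ p (a , b) ⟧
  row q a = begin
    count p (filterᵇ q (map (a ,_) (allFin n)))   ≡⟨ count-filterᵇ p q (map (a ,_) (allFin n)) ⟩
    count (λ ab → q ab ∧ p ab) (map (a ,_) (allFin n))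
                                                  ≡⟨ count-map (λ ab → q ab ∧ p ab) (a ,_) (allFin n) ⟩
    count (λ b → q (a , b) ∧ p (a , b)) (allFin n) ≡⟨ count≡∑ (λ b → q (a , b) ∧ p (a , b)) (allFin n) ⟩
    ∑[ b ∈ allFin n ] ⟦ q (a , b) ∧ p (a , b) ⟧    ≡⟨ ∑ᴸ-tabulate id (λ b → ⟦ q (a , b) ∧ p (a , b) ⟧) ⟩
    ∑[ b < n ] ⟦ q (a , b) ∧ p (a , b) ⟧           ∎

count-pairs2-symmetric : ∀ {n} (p : Fin n × Fin n → Bool) →
                         (∀ a b → p (a , b) ≡ p (b , a)) → (∀ a → p (a , a) ≡ false) →
                         2 * count p (pairs2 n) ≡ ∑[ a < n ] ∑[ b < n ] ⟦ p (a , b) ⟧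
count-pairs2-symmetric {n} p p-sym p-irrefl = begin
  2 * count p (pairs2 n)                        ≡⟨ cong (2 *_) (count-pairs2 p) ⟩
  2 * S                                         ≡⟨ cong (S +_) (trans (ℕ.+-identityʳ S) S≡S′) ⟩
  S + S′                                        ≡⟨ ∑-distrib-+ (λ a → sum (below a)) (λ a → sum (above a)) ⟨
  ∑[ a < n ] (sum (below a) + sum (above a))    ≡⟨ sum-cong-≗ (λ a → ∑-distrib-+ (below a) (above a)) ⟨
  ∑[ a < n ] ∑[ b < n ] (below a b + above a b) ≡⟨ sum-cong-≗ (λ a → sum-cong-≗ (λ b → split a b)) ⟩
  ∑[ a < n ] ∑[ b < n ] ⟦ p (a , b) ⟧           ∎
  where
  below above : Fin n → Fin n → ℕ
  below a b = ⟦ (toℕ a <ᵇ toℕ b) ∧ p (a , b) ⟧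
  above a b = ⟦ (toℕ b <ᵇ toℕ a) ∧ p (a , b) ⟧
  S S′ : ℕ
  S  = ∑[ a < n ] ∑[ b < n ] below a b
  S′ = ∑[ a < n ] ∑[ b < n ] above a b
  S≡S′ : S ≡ S′
  S≡S′ = trans (∑-comm below) (sum-cong-≗ λ a → sum-cong-≗ λ b →
                                 cong (λ t → ⟦ (toℕ b <ᵇ toℕ a) ∧ t ⟧) (p-sym b a))
  split : ∀ a b → below a b + above a b ≡ ⟦ p (a , b) ⟧
  split a b = ⟦<ᵇ⟧-split a b (p (a , b)) (λ { refl → p-irrefl a })

samePair-swap : ∀ {v} (x y a b : Fin v) → samePair x y a b ≡ samePair y x a b
samePair-swap x y a b =
  trans (∨-comm (x == a ∧ y == b) _) (cong₂ _∨_ (∧-comm (x == b) (y == a)) (∧-comm (x == a) (y == b)))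

samePair-diagˡ : ∀ {v} {a b : Fin v} x → a ≢ b → samePair x x a b ≡ false
samePair-diagˡ {a = a} {b} x a≢b with x ≟ a
... | yes refl rewrite ==-≢ a≢b = refl
... | no _     = ∧-zeroʳ (x == b)

samePair-diagʳ : ∀ {v} {x y : Fin v} → x ≢ y → ∀ a → samePair x y a a ≡ false
samePair-diagʳ {x = x} {y} x≢y a with x ≟ a
... | yes refl rewrite ==-≢ (x≢y ∘ sym) = refl
... | no _     = refl

⟦samePair⟧ : ∀ {v} {x y : Fin v} → x ≢ y → ∀ a b →
             ⟦ samePair x y a b ⟧ ≡ ⟦ x == a ⟧ * ⟦ y == b ⟧ + ⟦ y == a ⟧ * ⟦ x == b ⟧
⟦samePair⟧ {x = x} {y} x≢y a b with x ≟ a | y ≟ a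
... | yes refl | yes refl = contradiction refl x≢y
... | yes refl | no _     rewrite ∧-zeroʳ (x == b) | ∨-identityʳ (y == b) =
  sym (trans (ℕ.+-identityʳ _) (ℕ.+-identityʳ _))
... | no _     | yes refl rewrite ∧-identityʳ (x == b) = sym (ℕ.+-identityʳ _)
... | no _     | no _     rewrite ∧-zeroʳ (x == b) = refl

count-samePair : ∀ {n} {x y : Fin n} → x ≢ y → count (uncurry (samePair x y)) (pairs2 n) ≡ 1
count-samePair {n} {x} {y} x≢y = ℕ.*-cancelˡ-≡ _ 1 2 (begin
  2 * count (uncurry (samePair x y)) (pairs2 n)
    ≡⟨ count-pairs2-symmetric _ (λ a b → ∨-comm (x == a ∧ y == b) (x == b ∧ y == a)) (samePair-diagʳ x≢y) ⟩
  ∑[ a < n ] ∑[ b < n ] ⟦ samePair x y a b ⟧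
    ≡⟨ sum-cong-≗ (λ a → trans (sum-cong-≗ (⟦samePair⟧ x≢y a)) (∑-distrib-+ (term x y a) (term y x a))) ⟩
  ∑[ a < n ] (sum (term x y a) + sum (term y x a))
    ≡⟨ sum-cong-≗ (λ a → cong₂ _+_ (row x y a) (row y x a)) ⟩
  ∑[ a < n ] (⟦ x == a ⟧ * 1 + ⟦ y == a ⟧ * 1)
    ≡⟨ ∑-distrib-+ (λ a → ⟦ x == a ⟧ * 1) (λ a → ⟦ y == a ⟧ * 1) ⟩
  ∑[ a < n ] (⟦ x == a ⟧ * 1) + ∑[ a < n ] (⟦ y == a ⟧ * 1)
    ≡⟨ cong₂ _+_ (∑-δ x (λ _ → 1)) (∑-δ y (λ _ → 1)) ⟩
  2 ∎)
  where
  term : Fin n → Fin n → Fin n → Fin n → ℕ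
  term x y a b = ⟦ x == a ⟧ * ⟦ y == b ⟧
  row : ∀ x y a → sum (term x y a) ≡ ⟦ x == a ⟧ * 1
  row x y a = trans (sym (*-distribˡ-sum ⟦ x == a ⟧ (λ b → ⟦ y == b ⟧))) (cong (⟦ x == a ⟧ *_) (∑-indicator y))

-- Blocks through a pair

hasPair-swap : ∀ {v} (x y : Fin v) B → hasPair x y B ≡ hasPair y x B
hasPair-swap x y (a , b , c , d) = cong₂ _∨_ (samePair-swap x y a b) (samePair-swap x y c d)

hasPair-diag : ∀ {v} (x : Fin v) {B} → Distinct4 B → hasPair x x B ≡ false
hasPair-diag x (ab , _ , _ , _ , _ , cd) = cong₂ _∨_ (samePair-diagˡ x ab) (samePair-diagˡ x cd)

hasTriple-swap : ∀ {v} (x y z : Fin v) B → hasTriple x y z B ≡ hasTriple x z y B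
hasTriple-swap x y z B = cong (inBlock x B ∧_) (∧-comm (inBlock y B) (inBlock z B))

hasTriple-rotate : ∀ {v} (x y z : Fin v) B → hasTriple x y z B ≡ hasTriple y z x B
hasTriple-rotate x y z B =
  trans (∧-comm (inBlock x B) _) (∧-assoc (inBlock y B) (inBlock z B) (inBlock x B))

∑-inBlock : ∀ {v} (B : NBlock v) → Distinct4 B → ∑[ z < v ] ⟦ inBlock z B ⟧ ≡ 4
∑-inBlock {v} B dB = begin
  ∑[ z < v ] ⟦ inBlock z B ⟧                 ≡⟨ sum-cong-≗ by-corners ⟩
  ∑[ z < v ] ∑[ k < 4 ] ⟦ corner B k == z ⟧  ≡⟨ ∑-comm (λ z k → ⟦ corner B k == z ⟧) ⟩
  ∑[ k < 4 ] ∑[ z < v ] ⟦ corner B k == z ⟧  ≡⟨ sum-cong-≗ (∑-indicator ∘ corner B) ⟩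
  4                                          ∎
  where
  pos : Fin v → Maybe (Fin 4)
  pos = position (corner B)
  real : ∀ z → Coordinate _≐_ (corner B) z (pos z)
  real = position-coordinate (corner B) (corner-injective dB)
  by-corners : ∀ z → ⟦ inBlock z B ⟧ ≡ ∑[ k < 4 ] ⟦ corner B k == z ⟧
  by-corners z = begin
    ⟦ inBlock z B ⟧                 ≡⟨ cong ⟦_⟧ (inBlock-map _≐_ (corner B) (real z) indices) ⟩
    ⟦ inQuad _≐_ (pos z) indices ⟧  ≡⟨ inQuad-indices (pos z) ⟩
    ∑[ k < 4 ] ⟦ pos z ≐ k ⟧        ≡⟨ sum-cong-≗ (λ k → cong ⟦_⟧ (agrees (real z) k)) ⟨
    ∑[ k < 4 ] ⟦ z == corner B k ⟧  ≡⟨ sum-cong-≗ (λ k → cong ⟦_⟧ (==-sym z (corner B k))) ⟩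
    ∑[ k < 4 ] ⟦ corner B k == z ⟧  ∎

module _ {v} {x y : Fin v} (x≢y : x ≢ y) (B : NBlock v) (dB : Distinct4 B) where

  ∑-inBlock-avoiding : inBlock x B ≡ true → inBlock y B ≡ true →
                       ∑[ z < v ] ⟦ avoiding x y z ∧ inBlock z B ⟧ ≡ 2
  ∑-inBlock-avoiding x∈B y∈B = ℕ.+-cancelʳ-≡ 2 S 2 (begin
    S + 2                                  ≡⟨ ℕ.+-assoc S 1 1 ⟨
    S + 1 + 1                              ≡⟨ cong₂ (λ s t → S + ⟦ s ⟧ + ⟦ t ⟧) x∈B y∈B ⟨
    S + ⟦ inBlock x B ⟧ + ⟦ inBlock y B ⟧  ≡⟨ ∑-remove₂ x≢y (λ z → inBlock z B) ⟩
    ∑[ z < v ] ⟦ inBlock z B ⟧             ≡⟨ ∑-inBlock B dB ⟩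
    4                                      ∎)
    where
    S = ∑[ z < v ] ⟦ avoiding x y z ∧ inBlock z B ⟧

  ∑-hasTriple-avoiding : ∑[ z < v ] ⟦ avoiding x y z ∧ hasTriple x y z B ⟧ ≡ 2 * ⟦ inBlock x B ∧ inBlock y B ⟧
  ∑-hasTriple-avoiding with inBlock x B in x∈B | inBlock y B in y∈B
  ... | true  | true  = ∑-inBlock-avoiding x∈B y∈B
  ... | true  | false = ∑-zero (λ z → cong ⟦_⟧ (∧-zeroʳ (avoiding x y z)))
  ... | false | _     = ∑-zero (λ z → cong ⟦_⟧ (∧-zeroʳ (avoiding x y z)))

module _ {v} (N : NestedSQS v) where

  mult-sym : ∀ x y → mult N x y ≡ mult N y x
  mult-sym x y = count-cong (hasPair-swap x y) (blocks N)

  mult-diag : ∀ x → mult N x x ≡ 0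
  mult-diag x = count-none (hasPair-diag x) (distinct N)

  blocksThrough : Fin v → Fin v → ℕ
  blocksThrough x y = count (λ B → inBlock x B ∧ inBlock y B) (blocks N)

  module _ {x y : Fin v} (x≢y : x ≢ y) where

    steiner-avoiding : ∀ z → ∑[ B ∈ blocks N ] ⟦ avoiding x y z ∧ hasTriple x y z B ⟧ ≡ ⟦ avoiding x y z ⟧
    steiner-avoiding z with x ≟ z | y ≟ z
    ... | yes _  | _      = ∑ᴸ-zero (blocks N)
    ... | no _   | yes _  = ∑ᴸ-zero (blocks N)
    ... | no x≢z | no y≢z = trans (sym (count≡∑ (hasTriple x y z) (blocks N))) (steiner N x y z x≢y x≢z y≢z)

    2*blocksThrough≡v∸2 : 2 * blocksThrough x y ≡ v ∸ 2
    2*blocksThrough≡v∸2 = begin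
      2 * blocksThrough x y
        ≡⟨ cong (2 *_) (count≡∑ _ (blocks N)) ⟩
      2 * ∑[ B ∈ blocks N ] ⟦ inBlock x B ∧ inBlock y B ⟧
        ≡⟨ ∑ᴸ-* 2 (λ B → ⟦ inBlock x B ∧ inBlock y B ⟧) (blocks N) ⟨
      ∑[ B ∈ blocks N ] (2 * ⟦ inBlock x B ∧ inBlock y B ⟧)
        ≡⟨ ∑ᴸ-cong-All (λ dB → sym (∑-hasTriple-avoiding x≢y _ dB)) (distinct N) ⟩
      ∑[ B ∈ blocks N ] ∑[ z < v ] ⟦ avoiding x y z ∧ hasTriple x y z B ⟧
        ≡⟨ ∑ᴸ-∑ (λ B z → ⟦ avoiding x y z ∧ hasTriple x y z B ⟧) (blocks N) ⟩
      ∑[ z < v ] ∑[ B ∈ blocks N ] ⟦ avoiding x y z ∧ hasTriple x y z B ⟧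
        ≡⟨ sum-cong-≗ steiner-avoiding ⟩
      ∑[ z < v ] ⟦ avoiding x y z ⟧
        ≡⟨ ∑-others₂ x≢y ⟩
      v ∸ 2 ∎

    blocksThrough≡[v∸2]/2 : blocksThrough x y ≡ (v ∸ 2) / 2
    blocksThrough≡[v∸2]/2 = sym (begin
      (v ∸ 2) / 2                ≡⟨ cong (_/ 2) 2*blocksThrough≡v∸2 ⟨
      2 * blocksThrough x y / 2  ≡⟨ cong (_/ 2) (ℕ.*-comm 2 (blocksThrough x y)) ⟩
      blocksThrough x y * 2 / 2  ≡⟨ m*n/n≡m (blocksThrough x y) 2 ⟩
      blocksThrough x y          ∎)

-- The double

fin2-pigeonhole : (i j k : Fin 2) → i ≢ j → i ≢ k → j ≢ k → ⊥
fin2-pigeonhole 0F 0F _  i≢j _   _   = i≢j refl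
fin2-pigeonhole 1F 1F _  i≢j _   _   = i≢j refl
fin2-pigeonhole 0F 1F 0F _   i≢k _   = i≢k refl
fin2-pigeonhole 0F 1F 1F _   _   j≢k = j≢k refl
fin2-pigeonhole 1F 0F 0F _   _   j≢k = j≢k refl
fin2-pigeonhole 1F 0F 1F _   i≢k _   = i≢k refl

copies-differ : ∀ {v} {i j : Fin 2} {x : Fin v} → combine i x ≢ combine j x → i ≢ j
copies-differ {x = x} p≢q i≡j = p≢q (cong (λ k → combine k x) i≡j)

module Doubling {v} (N : NestedSQS v) where

  doubled : NBlock v → List (NBlock (2 * v))
  doubled B = map (mapQuad (realise (corner B))) blockTemplates

  pairBlock : Fin v × Fin v → NBlock (2 * v)
  pairBlock ab = mapQuad (realise (endpoints ab)) pairTemplate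

  doubleBlocks : List (NBlock (2 * v))
  doubleBlocks = concatMap doubled (blocks N) ++ map pairBlock (pairs2 v)

  count-doubleBlocks : ∀ p → count p doubleBlocks ≡
                       ∑[ B ∈ blocks N ] count p (doubled B) + count (p ∘ pairBlock) (pairs2 v)
  count-doubleBlocks p =
    trans (count-++ p (concatMap doubled (blocks N)) (map pairBlock (pairs2 v)))
          (cong₂ _+_ (count-concatMap p doubled (blocks N)) (count-map p pairBlock (pairs2 v)))

  doubleBlocks-distinct : All Distinct4 doubleBlocks
  doubleBlocks-distinct =
    Allₚ.++⁺ (Allₚ.concat⁺ (Allₚ.map⁺ (All.map doubled-distinct (distinct N))))
             (Allₚ.map⁺ (All.map pairBlock-distinct pairs2-distinct))
    where
    doubled-distinct : ∀ {B} → Distinct4 B → All Distinct4 (doubled B)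
    doubled-distinct dB =
      Allₚ.map⁺ (All.map (Distinct-map (realise-injective (corner-injective dB))) blockTemplates-distinct)
    pairBlock-distinct : ∀ {ab} → uncurry _≢_ ab → Distinct4 (pairBlock ab)
    pairBlock-distinct a≢b = Distinct-map (realise-injective (endpoints-injective a≢b)) pairTemplate-distinct

  module _ {B : NBlock v} (dB : Distinct4 B) where

    private
      pos : Fin v → Maybe (Fin 4)
      pos = position (corner B)

      real : ∀ x → Coordinate _≐_ (corner B) x (pos x)
      real = position-coordinate (corner B) (corner-injective dB)

      local : ∀ i x → Coordinate matches (realise (corner B)) (combine i x) (i , pos x)
      local = realise-coordinate (corner-injective dB)

      triples-local : ∀ i j k x y z → count (hasTriple (combine i x) (combine j y) (combine k z)) (doubled B) ≡
                      count (tripleIn matches (i , pos x) (j , pos y) (k , pos z)) blockTemplates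
      triples-local i j k x y z =
        trans (count-map (hasTriple (combine i x) (combine j y) (combine k z)) (mapQuad (realise (corner B))) blockTemplates)
        (count-cong (hasTriple-map matches _ (local i x) (local j y) (local k z)) blockTemplates)

      pairs-local : ∀ i j x y → count (hasPair (combine i x) (combine j y)) (doubled B) ≡
                    count (pairOf matches (i , pos x) (j , pos y)) blockTemplates
      pairs-local i j x y =
        trans (count-map (hasPair (combine i x) (combine j y)) (mapQuad (realise (corner B))) blockTemplates)
        (count-cong (hasPair-map matches _ (local i x) (local j y)) blockTemplates)

    doubled-triple : ∀ i j k {x y z} → x ≢ y → x ≢ z → y ≢ z →
                     count (hasTriple (combine i x) (combine j y) (combine k z)) (doubled B) ≡ ⟦ hasTriple x y z B ⟧
    doubled-triple i j k {x} {y} {z} x≢y x≢z y≢z = begin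
      count (hasTriple (combine i x) (combine j y) (combine k z)) (doubled B)
        ≡⟨ triples-local i j k x y z ⟩
      count (tripleIn matches (i , pos x) (j , pos y) (k , pos z)) blockTemplates
        ≡⟨ blockTemplates-triple i j k (pos x) (pos y) (pos z) (apart x≢y) (apart x≢z) (apart y≢z) ⟩
      ⟦ tripleIn _≐_ (pos x) (pos y) (pos z) indices ⟧
        ≡⟨ cong ⟦_⟧ (hasTriple-map _≐_ (corner B) (real x) (real y) (real z) indices) ⟨
      ⟦ hasTriple x y z B ⟧ ∎
      where apart = position-apart (corner B)

    doubled-twin-triple : ∀ {i j} k {x z} → i ≢ j →
                          count (hasTriple (combine i x) (combine j x) (combine k z)) (doubled B) ≡ 0
    doubled-twin-triple {i} {j} k {x} {z} i≢j =
      trans (triples-local i j k x x z) (blockTemplates-twin-triple i j k (pos x) (pos z) i≢j)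

    doubled-pair : ∀ i {x y} → x ≢ y → count (hasPair (combine i x) (combine i y)) (doubled B) ≡
                                       ⟦ inBlock x B ∧ inBlock y B ⟧ + ⟦ hasPair x y B ⟧
    doubled-pair i {x} {y} x≢y = begin
      count (hasPair (combine i x) (combine i y)) (doubled B)
        ≡⟨ pairs-local i i x y ⟩
      count (pairOf matches (i , pos x) (i , pos y)) blockTemplates
        ≡⟨ blockTemplates-pair i (pos x) (pos y) (position-apart (corner B) x≢y) ⟩
      ⟦ inQuad _≐_ (pos x) indices ∧ inQuad _≐_ (pos y) indices ⟧ + ⟦ pairOf _≐_ (pos x) (pos y) indices ⟧
        ≡⟨ cong₂ (λ s t → ⟦ s ⟧ + ⟦ t ⟧)
                 (cong₂ _∧_ (inBlock-map _≐_ (corner B) (real x) indices)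
                            (inBlock-map _≐_ (corner B) (real y) indices))
                 (hasPair-map _≐_ (corner B) (real x) (real y) indices) ⟨
      ⟦ inBlock x B ∧ inBlock y B ⟧ + ⟦ hasPair x y B ⟧ ∎

    doubled-cross-pair : ∀ {i j} x y → i ≢ j → count (hasPair (combine i x) (combine j y)) (doubled B) ≡ 0
    doubled-cross-pair {i} {j} x y i≢j =
      trans (pairs-local i j x y) (blockTemplates-cross-pair i j (pos x) (pos y) i≢j)

  module _ {a b : Fin v} (a≢b : a ≢ b) where

    private
      pos : Fin v → Maybe (Fin 2)
      pos = position (endpoints (a , b))

      real : ∀ x → Coordinate _≐_ (endpoints (a , b)) x (pos x)
      real = position-coordinate (endpoints (a , b)) (endpoints-injective a≢b)

      local : ∀ i x → Coordinate matches (realise (endpoints (a , b))) (combine i x) (i , pos x)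
      local = realise-coordinate (endpoints-injective a≢b)

      apart : ∀ {x y} → x ≢ y → Apart (pos x) (pos y)
      apart = position-apart (endpoints (a , b))

    pairBlock-triple : ∀ i j k {x y z} → x ≢ y → x ≢ z → y ≢ z →
                       hasTriple (combine i x) (combine j y) (combine k z) (pairBlock (a , b)) ≡ false
    pairBlock-triple i j k {x} {y} {z} x≢y x≢z y≢z =
      trans (hasTriple-map matches _ (local i x) (local j y) (local k z) pairTemplate)
            (pairTemplate-triple i j k (pos x) (pos y) (pos z) (apart x≢y) (apart x≢z) (apart y≢z))

    pairBlock-twin-triple : ∀ {i j} k {x z} → i ≢ j → x ≢ z →
                            hasTriple (combine i x) (combine j x) (combine k z) (pairBlock (a , b)) ≡ samePair x z a b
    pairBlock-twin-triple {i} {j} k {x} {z} i≢j x≢z =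
      trans (hasTriple-map matches _ (local i x) (local j x) (local k z) pairTemplate)
            (trans (pairTemplate-twin-triple i j k (pos x) (pos z) i≢j (apart x≢z))
                   (sym (samePair-map _≐_ _ (real x) (real z) 0F 1F)))

    pairBlock-pair : ∀ i {x y} → hasPair (combine i x) (combine i y) (pairBlock (a , b)) ≡ samePair x y a b
    pairBlock-pair i {x} {y} =
      trans (hasPair-map matches _ (local i x) (local i y) pairTemplate)
            (trans (pairTemplate-pair i (pos x) (pos y)) (sym (samePair-map _≐_ _ (real x) (real y) 0F 1F)))

    pairBlock-cross-pair : ∀ {i j} x y → i ≢ j → hasPair (combine i x) (combine j y) (pairBlock (a , b)) ≡ false
    pairBlock-cross-pair {i} {j} x y i≢j =
      trans (hasPair-map matches _ (local i x) (local j y) pairTemplate)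
            (pairTemplate-cross-pair i j (pos x) (pos y) i≢j)

  steiner-distinct : ∀ i j k {x y z} → x ≢ y → x ≢ z → y ≢ z →
                     count (hasTriple (combine i x) (combine j y) (combine k z)) doubleBlocks ≡ 1
  steiner-distinct i j k {x} {y} {z} x≢y x≢z y≢z = begin
    count P doubleBlocks
      ≡⟨ count-doubleBlocks P ⟩
    ∑[ B ∈ blocks N ] count P (doubled B) + count (P ∘ pairBlock) (pairs2 v)
      ≡⟨ cong₂ _+_ (∑ᴸ-cong-All (λ dB → doubled-triple dB i j k x≢y x≢z y≢z) (distinct N))
                   (count-none (λ a≢b → pairBlock-triple a≢b i j k x≢y x≢z y≢z) pairs2-distinct) ⟩
    ∑[ B ∈ blocks N ] ⟦ hasTriple x y z B ⟧ + 0
      ≡⟨ cong (_+ 0) (count≡∑ (hasTriple x y z) (blocks N)) ⟨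
    count (hasTriple x y z) (blocks N) + 0
      ≡⟨ cong (_+ 0) (steiner N x y z x≢y x≢z y≢z) ⟩
    1 ∎
    where P = hasTriple (combine i x) (combine j y) (combine k z)

  steiner-twin : ∀ {i j} k {x z} → i ≢ j → x ≢ z →
                 count (hasTriple (combine i x) (combine j x) (combine k z)) doubleBlocks ≡ 1
  steiner-twin {i} {j} k {x} {z} i≢j x≢z = begin
    count P doubleBlocks
      ≡⟨ count-doubleBlocks P ⟩
    ∑[ B ∈ blocks N ] count P (doubled B) + count (P ∘ pairBlock) (pairs2 v)
      ≡⟨ cong₂ _+_ (trans (∑ᴸ-cong-All (λ dB → doubled-twin-triple dB k i≢j) (distinct N)) (∑ᴸ-zero (blocks N)))
                   (count-cong-All (λ a≢b → pairBlock-twin-triple a≢b k i≢j x≢z) pairs2-distinct) ⟩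
    count (uncurry (samePair x z)) (pairs2 v)
      ≡⟨ count-samePair x≢z ⟩
    1 ∎
    where P = hasTriple (combine i x) (combine j x) (combine k z)

  steiner-cases : ∀ i x j y k z → Dec (x ≡ y) → Dec (x ≡ z) → Dec (y ≡ z) →
                  combine i x ≢ combine j y → combine i x ≢ combine k z → combine j y ≢ combine k z →
                  count (hasTriple (combine i x) (combine j y) (combine k z)) doubleBlocks ≡ 1
  steiner-cases i x j y k z (yes refl) (yes refl) _ p≢q p≢r q≢r =
    ⊥-elim (fin2-pigeonhole i j k (copies-differ p≢q) (copies-differ p≢r) (copies-differ q≢r))
  steiner-cases i x j y k z (yes refl) (no x≢z) _ p≢q _ _ =
    steiner-twin {i} {j} k (copies-differ p≢q) x≢z
  steiner-cases i x j y k z (no x≢y) (yes refl) _ _ p≢r _ =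
    trans (count-cong (hasTriple-swap (combine i x) (combine j y) (combine k x)) doubleBlocks)
          (steiner-twin {i} {k} j (copies-differ p≢r) x≢y)
  steiner-cases i x j y k z (no x≢y) (no _) (yes refl) _ _ q≢r =
    trans (count-cong (hasTriple-rotate (combine i x) (combine j y) (combine k y)) doubleBlocks)
          (steiner-twin {j} {k} i (copies-differ q≢r) (x≢y ∘ sym))
  steiner-cases i x j y k z (no x≢y) (no x≢z) (no y≢z) _ _ _ = steiner-distinct i j k x≢y x≢z y≢z

  Split : Fin (2 * v) → Set
  Split p = ∃ λ i → ∃ λ x → combine {2} {v} i x ≡ p

  double : NestedSQS (2 * v)
  double = record
    { blocks   = doubleBlocks
    ; distinct = doubleBlocks-distinct
    ; steiner  = λ p q r → steiner-split (combine-surjective p) (combine-surjective q) (combine-surjective r)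
    }
    where
    steiner-split : ∀ {p q r} → Split p → Split q → Split r → p ≢ q → p ≢ r → q ≢ r →
                    count (hasTriple p q r) doubleBlocks ≡ 1
    steiner-split (i , x , refl) (j , y , refl) (k , z , refl) =
      steiner-cases i x j y k z (x ≟ y) (x ≟ z) (y ≟ z)

  mult-same : ∀ i {x y} → x ≢ y → mult double (combine i x) (combine i y) ≡ suc (blocksThrough N x y + mult N x y)
  mult-same i {x} {y} x≢y = begin
    count P doubleBlocks
      ≡⟨ count-doubleBlocks P ⟩
    ∑[ B ∈ blocks N ] count P (doubled B) + count (P ∘ pairBlock) (pairs2 v)
      ≡⟨ cong₂ _+_ (∑ᴸ-cong-All (λ dB → doubled-pair dB i x≢y) (distinct N))
                   (count-cong-All (λ a≢b → pairBlock-pair a≢b i) pairs2-distinct) ⟩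
    ∑[ B ∈ blocks N ] (⟦ inBlock x B ∧ inBlock y B ⟧ + ⟦ hasPair x y B ⟧) + count (uncurry (samePair x y)) (pairs2 v)
      ≡⟨ cong₂ _+_ (∑ᴸ-+ (λ B → ⟦ inBlock x B ∧ inBlock y B ⟧) (λ B → ⟦ hasPair x y B ⟧) (blocks N))
                   (count-samePair x≢y) ⟩
    ∑[ B ∈ blocks N ] ⟦ inBlock x B ∧ inBlock y B ⟧ + ∑[ B ∈ blocks N ] ⟦ hasPair x y B ⟧ + 1
      ≡⟨ cong (_+ 1) (cong₂ _+_ (count≡∑ _ (blocks N)) (count≡∑ (hasPair x y) (blocks N))) ⟨
    blocksThrough N x y + mult N x y + 1
      ≡⟨ ℕ.+-comm _ 1 ⟩
    suc (blocksThrough N x y + mult N x y) ∎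
    where P = hasPair (combine i x) (combine i y)

  mult-cross : ∀ {i j} x y → i ≢ j → mult double (combine i x) (combine j y) ≡ 0
  mult-cross {i} {j} x y i≢j =
    trans (count-doubleBlocks (hasPair (combine i x) (combine j y)))
          (cong₂ _+_ (trans (∑ᴸ-cong-All (λ dB → doubled-cross-pair dB x y i≢j) (distinct N)) (∑ᴸ-zero (blocks N)))
                     (count-none (λ a≢b → pairBlock-cross-pair a≢b x y i≢j) pairs2-distinct))

  isND-double : ∀ i x j y → ⟦ 0 <ᵇ mult double (combine i x) (combine j y) ⟧ ≡ ⟦ i == j ⟧ * ⟦ not (x == y) ⟧
  isND-double i x j y = cases (i ≟ j) (x ≟ y)
    where
    cases : ∀ {i j x y} (i≟j : Dec (i ≡ j)) (x≟y : Dec (x ≡ y)) →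
            ⟦ 0 <ᵇ mult double (combine i x) (combine j y) ⟧ ≡ ⟦ isYes i≟j ⟧ * ⟦ not (isYes x≟y) ⟧
    cases {x = x} {y} (no i≢j)   _          = cong (λ m → ⟦ 0 <ᵇ m ⟧) (mult-cross x y i≢j)
    cases {i} {x = x} (yes refl) (yes refl) = cong (λ m → ⟦ 0 <ᵇ m ⟧) (mult-diag double (combine i x))
    cases {i}         (yes refl) (no x≢y)   = cong (λ m → ⟦ 0 <ᵇ m ⟧) (mult-same i x≢y)

  numND-double : numND double ≡ v * (v ∸ 1)
  numND-double = ℕ.*-cancelˡ-≡ _ _ 2 (begin
    2 * numND double
      ≡⟨ count-pairs2-symmetric _ (λ p q → cong (0 <ᵇ_) (mult-sym double p q))
                                  (λ p → cong (0 <ᵇ_) (mult-diag double p)) ⟩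
    ∑[ p < 2 * v ] ∑[ q < 2 * v ] ⟦ 0 <ᵇ mult double p q ⟧
      ≡⟨ ∑-combine 2 v (λ p → ∑[ q < 2 * v ] ⟦ 0 <ᵇ mult double p q ⟧) ⟩
    ∑[ i < 2 ] ∑[ x < v ] ∑[ q < 2 * v ] ⟦ 0 <ᵇ mult double (combine i x) q ⟧
      ≡⟨ sum-cong-≗ (λ i → sum-cong-≗ (row i)) ⟩
    ∑[ i < 2 ] ∑[ x < v ] (v ∸ 1)
      ≡⟨ trans (sum-cong-≗ {2} (λ i → ∑-const v (v ∸ 1))) (∑-const 2 (v * (v ∸ 1))) ⟩
    2 * (v * (v ∸ 1)) ∎)
    where
    row : ∀ i x → ∑[ q < 2 * v ] ⟦ 0 <ᵇ mult double (combine i x) q ⟧ ≡ v ∸ 1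
    row i x = begin
      ∑[ q < 2 * v ] ⟦ 0 <ᵇ mult double (combine i x) q ⟧
        ≡⟨ ∑-combine 2 v (λ q → ⟦ 0 <ᵇ mult double (combine i x) q ⟧) ⟩
      ∑[ j < 2 ] ∑[ y < v ] ⟦ 0 <ᵇ mult double (combine i x) (combine j y) ⟧
        ≡⟨ sum-cong-≗ (λ j → sum-cong-≗ (isND-double i x j)) ⟩
      ∑[ j < 2 ] ∑[ y < v ] (⟦ i == j ⟧ * ⟦ not (x == y) ⟧)
        ≡⟨ sum-cong-≗ (λ j → *-distribˡ-sum ⟦ i == j ⟧ (λ y → ⟦ not (x == y) ⟧)) ⟨
      ∑[ j < 2 ] (⟦ i == j ⟧ * ∑[ y < v ] ⟦ not (x == y) ⟧)
        ≡⟨ ∑-δ i (λ _ → ∑[ y < v ] ⟦ not (x == y) ⟧) ⟩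
      ∑[ y < v ] ⟦ not (x == y) ⟧
        ≡⟨ ∑-others x ⟩
      v ∸ 1 ∎

  double-uniform : ∀ μ → (∀ x y → x ≢ y → mult N x y ≡ μ) → Uniform double
  double-uniform μ mult≡μ = K , λ p q → uniform-split (combine-surjective p) (combine-surjective q)
    where
    K : ℕ
    K = suc ((v ∸ 2) / 2 + μ)
    uniform-split : ∀ {p q} → Split p → Split q → p ≢ q → IsND double p q → mult double p q ≡ K
    uniform-split (i , x , refl) (j , y , refl) p≢q nd = by-copies (i ≟ j) p≢q nd
      where
      by-copies : ∀ {i j} → Dec (i ≡ j) → combine i x ≢ combine j y → IsND double (combine i x) (combine j y) →
                  mult double (combine i x) (combine j y) ≡ K
      by-copies (no i≢j)       _   nd = contradiction (subst (0 <_) (mult-cross x y i≢j) nd) (ℕ.<-irrefl refl)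
      by-copies {i} (yes refl) p≢q _  =
        trans (mult-same i x≢y) (cong suc (cong₂ _+_ (blocksThrough≡[v∸2]/2 N x≢y) (mult≡μ x y x≢y)))
        where
        x≢y : x ≢ y
        x≢y = p≢q ∘ cong (combine i)

theorem4p4 : ∀ (v : ℕ) →
    (∃ λ (N : NestedSQS v) → CompleteUniform N) →
    ∃ λ (M : NestedSQS (2 * v)) → MinimumUniform M
theorem4p4 v (N , (μ , uniform) , complete) =
  double , double-uniform μ (λ x y x≢y → uniform x y x≢y (complete x y x≢y)) , minimum
  where
  open Doubling N

  2*v/2≡v : (2 * v) / 2 ≡ v
  2*v/2≡v = trans (cong (_/ 2) (ℕ.*-comm 2 v)) (m*n/n≡m v 2)

  minimum : numND double ≡ (2 * v) / 2 * ((2 * v) / 2 ∸ 1)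
  minimum rewrite 2*v/2≡v = numND-double
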